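{- Let $G$ be a connected bipartite simple graph with bipartition $(V_1,V_2)$ and edge cone $\mathbb{R}_+\mathcal{A}$, and let $\mathcal{A}'=\mathcal{A}\cup\{0\}$. If $A_2\subsetneq V_2$ and $F=H_{A_2}\cap\mathbb{R}_+\mathcal{A}$ is a facet of $\mathbb{R}_+\mathcal{A}$, then either $$H_{A_2}^-\cap\mathrm{aff}(\mathcal{A}')=H_{A_1}^-\cap\mathrm{aff}(\mathcal{A}')\quad\text{where } A_1=V_1\setminus N(A_2)\neq\emptyset,$$ or $$H_{A_2}^-\cap\mathrm{aff}(\mathcal{A}')=H_{e_i}^+\cap\mathrm{aff}(\mathcal{A}')$$ for some vertex $v_i$ such that $G\setminus\{v_i\}$ is connected.
   Context: Let $V(G)=\{v_1,\ldots,v_p\}$ and $e_i$ the $i$-th unit vector of $\mathbb{R}^p$; $H_{e_i}^+=\{x\mid x_i\ge0\}$. $\mathcal{A}$ is the set of vectors $e_i+e_j$ with $\{v_i,v_j\}$ an edge of $G$, and $\mathbb{R}_+\mathcal{A}$ (the edge cone) is the cone of their nonnegative real combinations; $\mathrm{aff}$ denotes affine hull. $N(B)$ is the set of vertices adjacent to some vertex of $B$; for $B\subset V_1$ or $B\subset V_2$, $H_B=\{x\mid\sum_{v_i\in B}x_i=\sum_{v_i\in N(B)}x_i\}$ and $H_B^-=\{x\mid\sum_{v_i\in B}x_i\le\sum_{v_i\in N(B)}x_i\}$. A facet of a cone $Q$ is a set $Q\cap H$, $H$ a hyperplane through the origin with $Q$ on one side, of dimension $\dim Q-1$.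
   Formalization: The ambient space is ℚ^p instead of ℝ^p, so the edge cone, aff(𝒜'), the halfspaces, the facet's hyperplane and the points counted for dimensions all lie in it. -}

module Defs where

open import Data.Nat.Base using (ℕ; zero; suc)
open import Data.Fin.Base using (Fin; zero; suc)
open import Data.Fin.Subset using (Subset; _∈_; _∉_; ∁; _∩_; _∪_; _─_; Nonempty)
open import Data.Bool.Base using (Bool; true; false; if_then_else_; _∧_; _∨_)
open import Data.Vec.Base using (tabulate; lookup)
open import Data.Rational using (ℚ; 0ℚ; 1ℚ; _+_; _*_; _≤_)
open import Data.Product using (Σ; ∃; _×_; _,_)
open import Data.Sum using (_⊎_)
open import Data.Unit using (⊤)
open import Relation.Binary.PropositionalEquality using (_≡_; _≢_)
open import Relation.Nullary using (¬_; yes; no)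
open import Data.Fin.Properties using (_≟_)

-- Finite simple graphs on the vertex set {v_0,…,v_{p-1}} ≅ Fin p

record SimpleGraph (p : ℕ) : Set where
  field
    adj        : Fin p → Fin p → Bool
    adj-sym    : ∀ i j → adj i j ≡ adj j i
    adj-irrefl : ∀ i → adj i i ≡ false
open SimpleGraph public

data Walk {p : ℕ} (G : SimpleGraph p) (allowed : Fin p → Set) : Fin p → Fin p → Set where
  here : ∀ {i} → allowed i → Walk G allowed i i
  step : ∀ {i j k} → allowed i → adj G i j ≡ true → Walk G allowed j k → Walk G allowed i k

Connected : ∀ {p} → SimpleGraph p → Set
Connected {p} G = ∀ (i j : Fin p) → Walk G (λ _ → ⊤) i j

-- G ∖ {v}: the induced subgraph on the remaining vertices is connected
ConnectedWithout : ∀ {p} → SimpleGraph p → Fin p → Set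
ConnectedWithout {p} G v =
  ∀ (i j : Fin p) → i ≢ v → j ≢ v → Walk G (λ u → u ≢ v) i j

IsBipartition : ∀ {p} → SimpleGraph p → Subset p → Subset p → Set
IsBipartition {p} G V₁ V₂ =
  (∀ (i : Fin p) → (i ∈ V₁ × i ∉ V₂) ⊎ (i ∉ V₁ × i ∈ V₂)) ×
  (∀ (i j : Fin p) → adj G i j ≡ true → (i ∈ V₁ × j ∈ V₂) ⊎ (i ∈ V₂ × j ∈ V₁))

anyFin : ∀ {n} → (Fin n → Bool) → Bool
anyFin {zero}  f = false
anyFin {suc n} f = f zero ∨ anyFin (λ i → f (suc i))

N : ∀ {p} → SimpleGraph p → Subset p → Subset p
N G B = tabulate (λ i → anyFin (λ j → lookup B j ∧ adj G j i))

-- Vectors in ℚ^p  (ℚ in place of ℝ)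

Vecℚ : ℕ → Set
Vecℚ p = Fin p → ℚ

Σᶠ : ∀ {n} → (Fin n → ℚ) → ℚ
Σᶠ {zero}  f = 0ℚ
Σᶠ {suc n} f = f zero + Σᶠ (λ i → f (suc i))

e : ∀ {p} → Fin p → Vecℚ p
e i j with i ≟ j
... | yes _ = 1ℚ
... | no  _ = 0ℚ

_·_ : ∀ {p} → Vecℚ p → Vecℚ p → ℚ
c · x = Σᶠ (λ k → c k * x k)

combo : ∀ {p} → (Fin p → Fin p → ℚ) → Vecℚ p
combo λc k = Σᶠ (λ i → Σᶠ (λ j → λc i j * (e i k + e j k)))

-- coefficients supported on edges of G (each edge {v_i,v_j} appears as (i,j) and (j,i))
OnEdges : ∀ {p} → SimpleGraph p → (Fin p → Fin p → ℚ) → Set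
OnEdges G λc = ∀ i j → adj G i j ≡ false → λc i j ≡ 0ℚ

EdgeCone : ∀ {p} → SimpleGraph p → Vecℚ p → Set
EdgeCone {p} G x = Σ (Fin p → Fin p → ℚ) λ λc →
  (∀ i j → 0ℚ ≤ λc i j) × OnEdges G λc × (∀ k → x k ≡ combo λc k)

-- aff(𝒜') with 𝒜' = 𝒜 ∪ {0}: affine combinations of the e_i + e_j and of 0
Aff' : ∀ {p} → SimpleGraph p → Vecℚ p → Set
Aff' {p} G x = Σ (Fin p → Fin p → ℚ) λ μ → Σ ℚ λ μ₀ →
  OnEdges G μ × (μ₀ + Σᶠ (λ i → Σᶠ (λ j → μ i j)) ≡ 1ℚ) ×
  (∀ k → x k ≡ combo μ k + μ₀ * 0ℚ)

sumOn : ∀ {p} → Subset p → Vecℚ p → ℚ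
sumOn B x = Σᶠ (λ i → if lookup B i then x i else 0ℚ)

H : ∀ {p} → SimpleGraph p → Subset p → Vecℚ p → Set
H G B x = sumOn B x ≡ sumOn (N G B) x

H⁻ : ∀ {p} → SimpleGraph p → Subset p → Vecℚ p → Set
H⁻ G B x = sumOn B x ≤ sumOn (N G B) x

H⁺e : ∀ {p} → Fin p → Vecℚ p → Set
H⁺e i x = 0ℚ ≤ x i

AffIndep : ∀ {p m} → (Fin m → Vecℚ p) → Set
AffIndep {p} {m} w = ∀ (c : Fin m → ℚ) → Σᶠ c ≡ 0ℚ →
  (∀ k → Σᶠ (λ l → c l * w l k) ≡ 0ℚ) → ∀ l → c l ≡ 0ℚ

AffDep : ∀ {p m} → (Fin m → Vecℚ p) → Set
AffDep {p} {m} w = Σ (Fin m → ℚ) λ c → (Σᶠ c ≡ 0ℚ) ×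
  (∀ k → Σᶠ (λ l → c l * w l k) ≡ 0ℚ) × ∃ λ l → c l ≢ 0ℚ

HasDim : ∀ {p} → (Vecℚ p → Set) → ℕ → Set
HasDim {p} S d =
  (Σ (Fin (suc d) → Vecℚ p) λ w → (∀ l → S (w l)) × AffIndep w) ×
  (∀ (w : Fin (suc (suc d)) → Vecℚ p) → (∀ l → S (w l)) → AffDep w)

IsFacet : ∀ {p} → (Vecℚ p → Set) → (Vecℚ p → Set) → Set
IsFacet {p} Q F = Σ (Vecℚ p) λ c →
  (∃ λ i → c i ≢ 0ℚ) ×
  (∀ x → Q x → c · x ≤ 0ℚ) ×
  (∀ x → F x → Q x × c · x ≡ 0ℚ) ×
  (∀ x → Q x → c · x ≡ 0ℚ → F x) ×
  (∃ λ d → HasDim Q (suc d) × HasDim F d)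

SameOnAff : ∀ {p} → SimpleGraph p → (Vecℚ p → Set) → (Vecℚ p → Set) → Set
SameOnAff G S T = ∀ x → Aff' G x → (S x → T x) × (T x → S x)

-- Write ψ_B = 𝟙_{N(B)} − 𝟙_B, so that H_B⁻ is the half-space ψ_B·x ≥ 0, and
-- σ = 𝟙_{V₁} − 𝟙_{V₂}, which vanishes on every e_i + e_j and hence on aff(𝒜′).
-- On an edge ψ_{A₂} takes the value 0 or 1, so the face F only uses the edges where it is 0.
-- Since F is a facet, no linear form independent of ψ_{A₂} on the cone can vanish on F.
-- If A₁ = V₁ ∖ N(A₂) is nonempty, this rules out a vertex v ∈ V₂ ∖ A₂ outside N(A₁)
-- (x_v would be such a form), and then ψ_{A₂} = ψ_{A₁} + σ.
-- If A₁ is empty, two vertices v, w ∈ V₂ ∖ A₂ would give the forms x_v, x_w; so V₂ ∖ A₂ = {i}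
-- and ψ_{A₂} = e_i + σ. Finally G ∖ {i} is connected, since otherwise σ restricted to one
-- component would be a second form.

module Submission where

open import Defs
open import Algebra.Bundles using (CommutativeMonoid)
import Algebra.Properties.CommutativeSemigroup as CommutativeSemigroupProperties
open import Data.Nat.Base as ℕ using (ℕ; zero; suc; z≤n)
import Data.Nat.Properties as ℕ
open import Data.Bool.Base using (Bool; true; false; if_then_else_; _∧_)
open import Data.Fin.Base using (Fin; zero; suc)
open import Data.Fin.Properties using (_≟_)
open import Data.Fin.Subset
  using (Subset; _∈_; _∉_; _⊆_; _⊂_; _∪_; _─_; ⁅_⁆; ∁; ∣_∣; Nonempty; inside; outside)
open import Data.Fin.Subset.Properties
  using (_∈?_; nonempty?; x∈p∧x∉q⇒x∈p─q; p─q⊆p; p⊆p∪q; x∈p∪q⁺; x∈p∪q⁻; p⊂q⇒∣p∣<∣q∣; ∣p∣≤n;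
         x∈⁅x⁆; x∈⁅y⁆⇒x≡y; x≢y⇒x∉⁅y⁆; x∉⁅y⁆⇒x≢y; x∉p⇒x∈∁p; x∈∁p⇒x∉p)
open import Data.Vec.Base using (_∷_; here; there; lookup)
open import Data.Vec.Properties using ([]=⇒lookup; lookup⇒[]=; lookup∘tabulate)
import Data.Vec.Functional as Vector
open import Data.Rational using (ℚ; 0ℚ; 1ℚ; _+_; _*_; -_; _-_; _≤_; nonNegative)
open import Data.Rational.Properties hiding (_≟_)
open import Data.Product using (∃; ∃₂; _×_; _,_; proj₁; proj₂)
open import Data.Sum using (_⊎_; inj₁; inj₂)
open import Function.Base using (_∘_)
open import Function.Bundles using (_⇔_; mk⇔; Equivalence)
open import Relation.Binary.PropositionalEquality
open import Relation.Nullary using (¬_; Dec; yes; no; contradiction)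

open CommutativeSemigroupProperties (CommutativeMonoid.commutativeSemigroup +-0-commutativeMonoid)
  using (interchange)
open CommutativeSemigroupProperties (CommutativeMonoid.commutativeSemigroup *-1-commutativeMonoid)
  using () renaming (x∙yz≈y∙xz to *-swapˡ)

-- Finite sums over ℚ

Σᶠ-cong : ∀ {n} {f g : Fin n → ℚ} → (∀ i → f i ≡ g i) → Σᶠ f ≡ Σᶠ g
Σᶠ-cong {zero}  f≗g = refl
Σᶠ-cong {suc n} f≗g = cong₂ _+_ (f≗g zero) (Σᶠ-cong (f≗g ∘ suc))

Σᶠ-zero : ∀ {n} {f : Fin n → ℚ} → (∀ i → f i ≡ 0ℚ) → Σᶠ f ≡ 0ℚ
Σᶠ-zero {zero}  f≗0 = refl
Σᶠ-zero {suc n} f≗0 = cong₂ _+_ (f≗0 zero) (Σᶠ-zero (f≗0 ∘ suc))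

Σᶠ-distrib-+ : ∀ {n} (f g : Fin n → ℚ) → Σᶠ (λ i → f i + g i) ≡ Σᶠ f + Σᶠ g
Σᶠ-distrib-+ {zero}  f g = refl
Σᶠ-distrib-+ {suc n} f g =
  trans (cong (f zero + g zero +_) (Σᶠ-distrib-+ (f ∘ suc) (g ∘ suc))) (interchange (f zero) (g zero) _ _)

Σᶠ-distribˡ-* : ∀ {n} (c : ℚ) (f : Fin n → ℚ) → Σᶠ (λ i → c * f i) ≡ c * Σᶠ f
Σᶠ-distribˡ-* {zero}  c f = sym (*-zeroʳ c)
Σᶠ-distribˡ-* {suc n} c f =
  trans (cong (c * f zero +_) (Σᶠ-distribˡ-* c (f ∘ suc))) (sym (*-distribˡ-+ c (f zero) _))

Σᶠ-neg : ∀ {n} (f : Fin n → ℚ) → Σᶠ (λ i → - f i) ≡ - Σᶠ f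
Σᶠ-neg {zero}  f = refl
Σᶠ-neg {suc n} f = trans (cong (- f zero +_) (Σᶠ-neg (f ∘ suc))) (sym (neg-distrib-+ (f zero) _))

Σᶠ-comm : ∀ {m n} (f : Fin m → Fin n → ℚ) →
  Σᶠ (λ i → Σᶠ (λ j → f i j)) ≡ Σᶠ (λ j → Σᶠ (λ i → f i j))
Σᶠ-comm {zero} {n} f = sym (Σᶠ-zero {n} (λ _ → refl))
Σᶠ-comm {suc m} f =
  trans (cong (Σᶠ (f zero) +_) (Σᶠ-comm (f ∘ suc))) (sym (Σᶠ-distrib-+ (f zero) _))

1ℚ≢0ℚ : 1ℚ ≢ 0ℚ
1ℚ≢0ℚ ()

+-nonneg-≡0ˡ : ∀ {a b} → 0ℚ ≤ a → 0ℚ ≤ b → a + b ≡ 0ℚ → a ≡ 0ℚ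
+-nonneg-≡0ˡ {a} {b} 0≤a 0≤b a+b≡0 = ≤-antisym a≤0 0≤a
  where
  a≤0 : a ≤ 0ℚ
  a≤0 = ≤-trans (≤-reflexive (sym (+-identityʳ a))) (≤-trans (+-monoʳ-≤ a 0≤b) (≤-reflexive a+b≡0))

Σᶠ-nonneg : ∀ {n} {f : Fin n → ℚ} → (∀ i → 0ℚ ≤ f i) → 0ℚ ≤ Σᶠ f
Σᶠ-nonneg {zero}  _   = ≤-refl
Σᶠ-nonneg {suc n} 0≤f = +-mono-≤ (0≤f zero) (Σᶠ-nonneg (0≤f ∘ suc))

Σᶠ-nonneg-≡0 : ∀ {n} {f : Fin n → ℚ} → (∀ i → 0ℚ ≤ f i) → Σᶠ f ≡ 0ℚ → ∀ i → f i ≡ 0ℚ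
Σᶠ-nonneg-≡0 {suc n} {f} 0≤f Σf≡0 zero = +-nonneg-≡0ˡ (0≤f zero) (Σᶠ-nonneg (0≤f ∘ suc)) Σf≡0
Σᶠ-nonneg-≡0 {suc n} {f} 0≤f Σf≡0 (suc i) = Σᶠ-nonneg-≡0 (0≤f ∘ suc) Σtail≡0 i
  where
  Σtail≡0 : Σᶠ (f ∘ suc) ≡ 0ℚ
  Σtail≡0 = +-nonneg-≡0ˡ (Σᶠ-nonneg (0≤f ∘ suc)) (0≤f zero) (trans (+-comm _ (f zero)) Σf≡0)

*-nonneg : ∀ {a b} → 0ℚ ≤ a → 0ℚ ≤ b → 0ℚ ≤ a * b
*-nonneg {a} {b} 0≤a 0≤b =
  ≤-trans (≤-reflexive (sym (*-zeroˡ b))) (*-monoʳ-≤-nonNeg b {{nonNegative 0≤b}} 0≤a)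

p≤q⇒0≤q-p : ∀ {p q} → p ≤ q → 0ℚ ≤ q - p
p≤q⇒0≤q-p {p} p≤q = ≤-trans (≤-reflexive (sym (+-inverseʳ p))) (+-monoˡ-≤ (- p) p≤q)

0≤q-p⇒p≤q : ∀ {p q} → 0ℚ ≤ q - p → p ≤ q
0≤q-p⇒p≤q {p} {q} 0≤q-p = begin
  p             ≡⟨ +-identityˡ p ⟨
  0ℚ + p        ≤⟨ +-monoˡ-≤ p 0≤q-p ⟩
  q - p + p     ≡⟨ +-assoc q (- p) p ⟩
  q + (- p + p) ≡⟨ cong (q +_) (+-inverseˡ p) ⟩
  q + 0ℚ        ≡⟨ +-identityʳ q ⟩
  q             ∎
  where open ≤-Reasoning

-- Unit vectors and linear forms

e-diag : ∀ {p} (i : Fin p) → e i i ≡ 1ℚ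
e-diag i with i ≟ i
... | yes _   = refl
... | no  i≢i = contradiction refl i≢i

e-offdiag : ∀ {p} {i k : Fin p} → i ≢ k → e i k ≡ 0ℚ
e-offdiag {i = i} {k} i≢k with i ≟ k
... | yes i≡k = contradiction i≡k i≢k
... | no  _   = refl

e-nonneg : ∀ {p} (i k : Fin p) → 0ℚ ≤ e i k
e-nonneg i k with i ≟ k
... | yes _ = nonNegative⁻¹ 1ℚ
... | no  _ = ≤-refl

e-suc : ∀ {p} (i k : Fin p) → e (suc i) (suc k) ≡ e i k
e-suc i k with i ≟ k
... | yes _ = refl
... | no  _ = refl

e-· : ∀ {p} (i : Fin p) (x : Vecℚ p) → e i · x ≡ x i
e-· {suc p} zero x =
  trans (cong₂ _+_ (*-identityˡ (x zero)) (Σᶠ-zero (λ k → *-zeroˡ (x (suc k))))) (+-identityʳ (x zero))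
e-· {suc p} (suc i) x = begin
  0ℚ * x zero + Σᶠ (λ k → e (suc i) (suc k) * x (suc k))
    ≡⟨ cong₂ _+_ (*-zeroˡ (x zero)) (Σᶠ-cong (λ k → cong (_* x (suc k)) (e-suc i k))) ⟩
  0ℚ + e i · (x ∘ suc) ≡⟨ +-identityˡ _ ⟩
  e i · (x ∘ suc)      ≡⟨ e-· i (x ∘ suc) ⟩
  x (suc i)            ∎
  where open ≡-Reasoning

·-e : ∀ {p} (a : Vecℚ p) (i : Fin p) → a · e i ≡ a i
·-e a i = trans (Σᶠ-cong (λ k → *-comm (a k) (e i k))) (e-· i a)

·-zeroʳ : ∀ {p} (a x : Vecℚ p) → (∀ k → x k ≡ 0ℚ) → a · x ≡ 0ℚ
·-zeroʳ a x x≗0 = Σᶠ-zero (λ k → trans (cong (a k *_) (x≗0 k)) (*-zeroʳ (a k)))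

·-distribˡ-+ : ∀ {p} (a x y : Vecℚ p) → a · (λ k → x k + y k) ≡ a · x + a · y
·-distribˡ-+ a x y =
  trans (Σᶠ-cong (λ k → *-distribˡ-+ (a k) (x k) (y k)))
        (Σᶠ-distrib-+ (λ k → a k * x k) (λ k → a k * y k))

·-distribʳ-+ : ∀ {p} (a b x : Vecℚ p) → (λ k → a k + b k) · x ≡ a · x + b · x
·-distribʳ-+ a b x =
  trans (Σᶠ-cong (λ k → *-distribʳ-+ (x k) (a k) (b k)))
        (Σᶠ-distrib-+ (λ k → a k * x k) (λ k → b k * x k))

·-negˡ : ∀ {p} (a x : Vecℚ p) → (λ k → - a k) · x ≡ - (a · x)
·-negˡ a x = trans (Σᶠ-cong (λ k → sym (neg-distribˡ-* (a k) (x k)))) (Σᶠ-neg (λ k → a k * x k))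

·-distribʳ-sub : ∀ {p} (a b x : Vecℚ p) → (λ k → a k - b k) · x ≡ a · x - b · x
·-distribʳ-sub a b x = trans (·-distribʳ-+ a (λ k → - b k) x) (cong (a · x +_) (·-negˡ b x))

·-scaleʳ : ∀ {p} (a : Vecℚ p) (c : ℚ) (x : Vecℚ p) → a · (λ k → c * x k) ≡ c * (a · x)
·-scaleʳ a c x = trans (Σᶠ-cong (λ k → *-swapˡ (a k) c (x k))) (Σᶠ-distribˡ-* c (λ k → a k * x k))

·-Σᶠ : ∀ {p m} (a : Vecℚ p) (w : Fin m → Vecℚ p) →
  a · (λ k → Σᶠ (λ l → w l k)) ≡ Σᶠ (λ l → a · w l)
·-Σᶠ a w =
  trans (Σᶠ-cong (λ k → sym (Σᶠ-distribˡ-* (a k) (λ l → w l k)))) (Σᶠ-comm (λ k l → a k * w l k))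

·-combo : ∀ {p} (a : Vecℚ p) (λc : Fin p → Fin p → ℚ) →
  a · combo λc ≡ Σᶠ (λ i → Σᶠ (λ j → λc i j * (a i + a j)))
·-combo a λc = begin
  a · combo λc
    ≡⟨ ·-Σᶠ a (λ i k → Σᶠ (λ j → λc i j * (e i k + e j k))) ⟩
  Σᶠ (λ i → a · (λ k → Σᶠ (λ j → λc i j * (e i k + e j k))))
    ≡⟨ Σᶠ-cong (λ i → ·-Σᶠ a (λ j k → λc i j * (e i k + e j k))) ⟩
  Σᶠ (λ i → Σᶠ (λ j → a · (λ k → λc i j * (e i k + e j k))))
    ≡⟨ Σᶠ-cong (λ i → Σᶠ-cong (λ j → ·-scaleʳ a (λc i j) (λ k → e i k + e j k))) ⟩
  Σᶠ (λ i → Σᶠ (λ j → λc i j * (a · (λ k → e i k + e j k))))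
    ≡⟨ Σᶠ-cong (λ i → Σᶠ-cong (λ j → cong (λc i j *_)
         (trans (·-distribˡ-+ a (e i) (e j)) (cong₂ _+_ (·-e a i) (·-e a j))))) ⟩
  Σᶠ (λ i → Σᶠ (λ j → λc i j * (a i + a j))) ∎
  where open ≡-Reasoning

-- Affine dimension

Codim1 : ∀ {p} → (Vecℚ p → Set) → (Vecℚ p → Set) → Set
Codim1 Q F = ∃ λ d → HasDim Q (suc d) × HasDim F d

·-dependency : ∀ {p m} (w : Fin m → Vecℚ p) (c : Fin m → ℚ) →
  (∀ k → Σᶠ (λ l → c l * w l k) ≡ 0ℚ) → ∀ a → Σᶠ (λ l → c l * (a · w l)) ≡ 0ℚ
·-dependency w c Σcw≡0 a = begin
  Σᶠ (λ l → c l * (a · w l))          ≡⟨ Σᶠ-cong (λ l → ·-scaleʳ a (c l) (w l)) ⟨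
  Σᶠ (λ l → a · (λ k → c l * w l k))  ≡⟨ ·-Σᶠ a (λ l k → c l * w l k) ⟨
  a · (λ k → Σᶠ (λ l → c l * w l k))  ≡⟨ ·-zeroʳ a _ Σcw≡0 ⟩
  0ℚ                                  ∎
  where open ≡-Reasoning

drop-zero-summands : ∀ {s t u : ℚ} → s ≡ 0ℚ → t ≡ 0ℚ → s + (t + u) ≡ 0ℚ → u ≡ 0ℚ
drop-zero-summands {u = u} refl refl s+t+u≡0 = trans (sym (trans (+-identityˡ _) (+-identityˡ u))) s+t+u≡0

·-dependency-∷∷ : ∀ {p m} (y z : Vecℚ p) (w : Fin m → Vecℚ p) (c : Fin (suc (suc m)) → ℚ) →
  (∀ k → Σᶠ (λ l → c l * (y Vector.∷ z Vector.∷ w) l k) ≡ 0ℚ) →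
  ∀ v → (∀ l → v · w l ≡ 0ℚ) → c zero * (v · y) + c (suc zero) * (v · z) ≡ 0ℚ
·-dependency-∷∷ y z w c Σcw≡0 v v⊥w = begin
  c zero * (v · y) + c (suc zero) * (v · z)
    ≡⟨ cong (c zero * (v · y) +_) (trans (cong (c (suc zero) * (v · z) +_) tail≡0) (+-identityʳ _)) ⟨
  c zero * (v · y) + (c (suc zero) * (v · z) + Σᶠ (λ l → c (suc (suc l)) * (v · w l)))
    ≡⟨ ·-dependency (y Vector.∷ z Vector.∷ w) c Σcw≡0 v ⟩
  0ℚ ∎
  where
  open ≡-Reasoning
  tail≡0 : Σᶠ (λ l → c (suc (suc l)) * (v · w l)) ≡ 0ℚ
  tail≡0 = Σᶠ-zero (λ l → trans (cong (c (suc (suc l)) *_) (v⊥w l)) (*-zeroʳ (c (suc (suc l)))))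

AffIndep-∷∷ : ∀ {p m} (a b y z : Vecℚ p) (w : Fin m → Vecℚ p) → AffIndep w →
  (∀ l → a · w l ≡ 0ℚ) → (∀ l → b · w l ≡ 0ℚ) → a · y ≡ 1ℚ → a · z ≡ 0ℚ → b · z ≡ 1ℚ →
  ¬ AffDep (y Vector.∷ z Vector.∷ w)
AffIndep-∷∷ a b y z w independent a⊥w b⊥w a·y≡1 a·z≡0 b·z≡1 (c , Σc≡0 , Σcw≡0 , l , cₗ≢0) =
  cₗ≢0 (c≡0 l)
  where
  open ≡-Reasoning

  c₀ c₁ : ℚ
  c₀ = c zero
  c₁ = c (suc zero)

  c₀≡0 : c₀ ≡ 0ℚ
  c₀≡0 = begin
    c₀                          ≡⟨ trans (+-identityʳ _) (*-identityʳ c₀) ⟨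
    c₀ * 1ℚ + 0ℚ                ≡⟨ cong (c₀ * 1ℚ +_) (*-zeroʳ c₁) ⟨
    c₀ * 1ℚ + c₁ * 0ℚ           ≡⟨ cong₂ (λ s t → c₀ * s + c₁ * t) a·y≡1 a·z≡0 ⟨
    c₀ * (a · y) + c₁ * (a · z) ≡⟨ ·-dependency-∷∷ y z w c Σcw≡0 a a⊥w ⟩
    0ℚ                          ∎

  c₁≡0 : c₁ ≡ 0ℚ
  c₁≡0 = begin
    c₁                          ≡⟨ trans (+-identityˡ _) (*-identityʳ c₁) ⟨
    0ℚ + c₁ * 1ℚ                ≡⟨ cong (_+ c₁ * 1ℚ) (trans (cong (_* (b · y)) c₀≡0) (*-zeroˡ (b · y))) ⟨
    c₀ * (b · y) + c₁ * 1ℚ      ≡⟨ cong (λ t → c₀ * (b · y) + c₁ * t) b·z≡1 ⟨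
    c₀ * (b · y) + c₁ * (b · z) ≡⟨ ·-dependency-∷∷ y z w c Σcw≡0 b b⊥w ⟩
    0ℚ                          ∎

  c≡0 : ∀ l → c l ≡ 0ℚ
  c≡0 zero          = c₀≡0
  c≡0 (suc zero)    = c₁≡0
  c≡0 (suc (suc l)) = independent (λ l → c (suc (suc l))) (drop-zero-summands c₀≡0 c₁≡0 Σc≡0)
    (λ k → drop-zero-summands (trans (cong (_* y k) c₀≡0) (*-zeroˡ (y k)))
                              (trans (cong (_* z k) c₁≡0) (*-zeroˡ (z k))) (Σcw≡0 k)) l

-- d + 1 independent points of F together with y and z would be d + 3 independent points of Q.
two-functionals⇒¬Codim1 : ∀ {p} {Q F : Vecℚ p → Set} (a b y z : Vecℚ p) →
  (∀ x → F x → Q x) → (∀ x → F x → a · x ≡ 0ℚ) → (∀ x → F x → b · x ≡ 0ℚ) →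
  Q y → Q z → a · y ≡ 1ℚ → a · z ≡ 0ℚ → b · z ≡ 1ℚ → ¬ Codim1 Q F
two-functionals⇒¬Codim1 {p} {Q} {F} a b y z F⊆Q a⊥F b⊥F y∈Q z∈Q a·y≡1 a·z≡0 b·z≡1
  (d , (_ , dependent) , (w , w∈F , independent) , _) =
  AffIndep-∷∷ a b y z w independent (λ l → a⊥F _ (w∈F l)) (λ l → b⊥F _ (w∈F l)) a·y≡1 a·z≡0 b·z≡1
    (dependent (y Vector.∷ z Vector.∷ w) points∈Q)
  where
  points∈Q : ∀ l → Q ((y Vector.∷ z Vector.∷ w) l)
  points∈Q zero          = y∈Q
  points∈Q (suc zero)    = z∈Q
  points∈Q (suc (suc l)) = F⊆Q _ (w∈F l)

-- The edge cone and aff(𝒜′)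

edgePoint : ∀ {p} → Fin p → Fin p → Vecℚ p
edgePoint s t = combo (λ i j → e s i * e t j)

·-edgePoint : ∀ {p} (a : Vecℚ p) (s t : Fin p) → a · edgePoint s t ≡ a s + a t
·-edgePoint a s t = begin
  a · edgePoint s t
    ≡⟨ ·-combo a (λ i j → e s i * e t j) ⟩
  Σᶠ (λ i → Σᶠ (λ j → e s i * e t j * (a i + a j)))
    ≡⟨ Σᶠ-cong (λ i → trans (Σᶠ-cong (λ j → *-assoc (e s i) (e t j) (a i + a j)))
                            (Σᶠ-distribˡ-* (e s i) (λ j → e t j * (a i + a j)))) ⟩
  Σᶠ (λ i → e s i * (e t · (λ j → a i + a j)))
    ≡⟨ Σᶠ-cong (λ i → cong (e s i *_) (e-· t (λ j → a i + a j))) ⟩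
  e s · (λ i → a i + a t)
    ≡⟨ e-· s (λ i → a i + a t) ⟩
  a s + a t ∎
  where open ≡-Reasoning

true≢false : ∀ {b} → b ≡ true → b ≢ false
true≢false refl ()

edgePoint∈EdgeCone : ∀ {p} (G : SimpleGraph p) {s t : Fin p} →
  adj G s t ≡ true → EdgeCone G (edgePoint s t)
edgePoint∈EdgeCone G {s} {t} st = (λ i j → e s i * e t j) , nonneg , onEdges , (λ _ → refl)
  where
  nonneg : ∀ i j → 0ℚ ≤ e s i * e t j
  nonneg i j = *-nonneg (e-nonneg s i) (e-nonneg t j)

  onEdges : OnEdges G (λ i j → e s i * e t j)
  onEdges i j ij = vanish (s ≟ i) (t ≟ j)
    where
    vanish : Dec (s ≡ i) → Dec (t ≡ j) → e s i * e t j ≡ 0ℚ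
    vanish (yes refl) (yes refl) = contradiction ij (true≢false st)
    vanish (no s≢i)   _          = trans (cong (_* e t j) (e-offdiag s≢i)) (*-zeroˡ (e t j))
    vanish (yes _)    (no t≢j)   = trans (cong (e s i *_) (e-offdiag t≢j)) (*-zeroʳ (e s i))

e-avoiding : ∀ {p} {v i j : Fin p} → i ≢ v → j ≢ v → e v i + e v j ≡ 0ℚ
e-avoiding i≢v j≢v = cong₂ _+_ (e-offdiag (≢-sym i≢v)) (e-offdiag (≢-sym j≢v))

e·edgePoint-incident : ∀ {p} {v u : Fin p} → u ≢ v → e v · edgePoint v u ≡ 1ℚ
e·edgePoint-incident {v = v} {u} u≢v =
  trans (·-edgePoint (e v) v u) (cong₂ _+_ (e-diag v) (e-offdiag (≢-sym u≢v)))

e·edgePoint-avoiding : ∀ {p} {v x y : Fin p} → x ≢ v → y ≢ v → e v · edgePoint x y ≡ 0ℚ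
e·edgePoint-avoiding {v = v} {x} {y} x≢v y≢v =
  trans (·-edgePoint (e v) x y) (e-avoiding x≢v y≢v)

·-Aff'≡0 : ∀ {p} (G : SimpleGraph p) (a : Vecℚ p) →
  (∀ {i j} → adj G i j ≡ true → a i + a j ≡ 0ℚ) → ∀ x → Aff' G x → a · x ≡ 0ℚ
·-Aff'≡0 G a a⊥edges x (μ , μ₀ , onEdges , _ , x≡) = begin
  a · x                                     ≡⟨ Σᶠ-cong (λ k → cong (a k *_) (x≡combo k)) ⟩
  a · combo μ                               ≡⟨ ·-combo a μ ⟩
  Σᶠ (λ i → Σᶠ (λ j → μ i j * (a i + a j))) ≡⟨ Σᶠ-zero (λ i → Σᶠ-zero (term i)) ⟩
  0ℚ                                        ∎
  where
  open ≡-Reasoning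
  x≡combo : ∀ k → x k ≡ combo μ k
  x≡combo k = trans (x≡ k) (trans (cong (combo μ k +_) (*-zeroʳ μ₀)) (+-identityʳ _))

  term : ∀ i j → μ i j * (a i + a j) ≡ 0ℚ
  term i j with adj G i j in ij
  ... | true  = trans (cong (μ i j *_) (a⊥edges ij)) (*-zeroʳ (μ i j))
  ... | false = trans (cong (_* (a i + a j)) (onEdges i j ij)) (*-zeroˡ (a i + a j))

-- A point of the cone on the hyperplane ψ·x = 0 only uses edges with ψ i + ψ j = 0
-- when ψ i + ψ j is never negative on an edge.
face-⊥ : ∀ {p} (G : SimpleGraph p) (ψ a : Vecℚ p) →
  (∀ {i j} → adj G i j ≡ true → ψ i + ψ j ≡ 0ℚ ⊎ ψ i + ψ j ≡ 1ℚ) →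
  (∀ {i j} → adj G i j ≡ true → ψ i + ψ j ≡ 0ℚ → a i + a j ≡ 0ℚ) →
  ∀ x → EdgeCone G x → ψ · x ≡ 0ℚ → a · x ≡ 0ℚ
face-⊥ {p} G ψ a ψ∈01 a⊥tight x (λc , λc≥0 , onEdges , x≡) ψ·x≡0 =
  trans (·-cone a) (Σᶠ-zero (λ i → Σᶠ-zero (a-term≡0 i)))
  where
  ·-cone : ∀ v → v · x ≡ Σᶠ (λ i → Σᶠ (λ j → λc i j * (v i + v j)))
  ·-cone v = trans (Σᶠ-cong (λ k → cong (v k *_) (x≡ k))) (·-combo v λc)

  off-edge : ∀ {i j} (v : Vecℚ p) → adj G i j ≡ false → λc i j * (v i + v j) ≡ 0ℚ
  off-edge {i} {j} v ij = trans (cong (_* (v i + v j)) (onEdges i j ij)) (*-zeroˡ (v i + v j))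

  ψ-term≥0 : ∀ i j → 0ℚ ≤ λc i j * (ψ i + ψ j)
  ψ-term≥0 i j with adj G i j in ij
  ... | false = ≤-reflexive (sym (off-edge ψ ij))
  ... | true with ψ∈01 ij
  ...   | inj₁ ψij≡0 = ≤-reflexive (sym (trans (cong (λc i j *_) ψij≡0) (*-zeroʳ (λc i j))))
  ...   | inj₂ ψij≡1 = ≤-trans (λc≥0 i j)
                         (≤-reflexive (sym (trans (cong (λc i j *_) ψij≡1) (*-identityʳ (λc i j)))))

  ψ-term≡0 : ∀ i j → λc i j * (ψ i + ψ j) ≡ 0ℚ
  ψ-term≡0 i = Σᶠ-nonneg-≡0 (ψ-term≥0 i)
    (Σᶠ-nonneg-≡0 (λ i → Σᶠ-nonneg (ψ-term≥0 i)) (trans (sym (·-cone ψ)) ψ·x≡0) i)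

  a-term≡0 : ∀ i j → λc i j * (a i + a j) ≡ 0ℚ
  a-term≡0 i j with adj G i j in ij
  ... | false = off-edge a ij
  ... | true with ψ∈01 ij
  ...   | inj₁ ψij≡0 = trans (cong (λc i j *_) (a⊥tight ij ψij≡0)) (*-zeroʳ (λc i j))
  ...   | inj₂ ψij≡1 = trans (cong (_* (a i + a j)) λcij≡0) (*-zeroˡ (a i + a j))
    where
    λcij≡0 : λc i j ≡ 0ℚ
    λcij≡0 = trans (sym (trans (cong (λc i j *_) ψij≡1) (*-identityʳ (λc i j)))) (ψ-term≡0 i j)

-- Indicator vectors, neighbourhoods and the half-spaces H_B⁻

x∈p─q⇒x∉q : ∀ {n} {x : Fin n} (p q : Subset n) → x ∈ p ─ q → x ∉ q
x∈p─q⇒x∉q (inside ∷ p) (outside ∷ q) here                     = λ ()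
x∈p─q⇒x∉q (_      ∷ p) (_       ∷ q) (there x∈p─q) (there x∈q) = x∈p─q⇒x∉q p q x∈p─q x∈q

x∈p─q⁻ : ∀ {n} {x : Fin n} (p q : Subset n) → x ∈ p ─ q → x ∈ p × x ∉ q
x∈p─q⁻ p q x∈p─q = p─q⊆p p q x∈p─q , x∈p─q⇒x∉q p q x∈p─q

¬Nonempty[p─q]⇒p⊆q : ∀ {n} {p q : Subset n} → ¬ Nonempty (p ─ q) → p ⊆ q
¬Nonempty[p─q]⇒p⊆q {q = q} p─q≡∅ {x} x∈p with x ∈? q
... | yes x∈q = x∈q
... | no  x∉q = contradiction (x , x∈p∧x∉q⇒x∈p─q x∈p x∉q) p─q≡∅

𝟙 : ∀ {p} → Subset p → Vecℚ p
𝟙 B k = if lookup B k then 1ℚ else 0ℚ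

𝟙-∈ : ∀ {p} {B : Subset p} {k} → k ∈ B → 𝟙 B k ≡ 1ℚ
𝟙-∈ k∈B rewrite []=⇒lookup k∈B = refl

𝟙-∉ : ∀ {p} {B : Subset p} {k} → k ∉ B → 𝟙 B k ≡ 0ℚ
𝟙-∉ {B = B} {k} k∉B with lookup B k in Bk
... | true  = contradiction (lookup⇒[]= k B Bk) k∉B
... | false = refl

𝟙*-∈ : ∀ {p} {B : Subset p} {k} (a : ℚ) → k ∈ B → 𝟙 B k * a ≡ a
𝟙*-∈ a k∈B = trans (cong (_* a) (𝟙-∈ k∈B)) (*-identityˡ a)

𝟙*-∉ : ∀ {p} {B : Subset p} {k} (a : ℚ) → k ∉ B → 𝟙 B k * a ≡ 0ℚ
𝟙*-∉ a k∉B = trans (cong (_* a) (𝟙-∉ k∉B)) (*-zeroˡ a)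

sumOn≡𝟙· : ∀ {p} (B : Subset p) (x : Vecℚ p) → sumOn B x ≡ 𝟙 B · x
sumOn≡𝟙· B x = Σᶠ-cong (λ k → masked (lookup B k) (x k))
  where
  masked : ∀ b y → (if b then y else 0ℚ) ≡ (if b then 1ℚ else 0ℚ) * y
  masked true  y = sym (*-identityˡ y)
  masked false y = sym (*-zeroˡ y)

anyFin⁺ : ∀ {n} (f : Fin n → Bool) {i} → f i ≡ true → anyFin f ≡ true
anyFin⁺ f {zero}  fi rewrite fi = refl
anyFin⁺ f {suc i} fi with f zero
... | true  = refl
... | false = anyFin⁺ (f ∘ suc) fi

anyFin⁻ : ∀ {n} (f : Fin n → Bool) → anyFin f ≡ true → ∃ λ i → f i ≡ true
anyFin⁻ {suc n} f anyf with f zero in f0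
... | true  = zero , f0
... | false = let i , fi = anyFin⁻ (f ∘ suc) anyf in suc i , fi

module _ {p} (G : SimpleGraph p) where

  N⁺ : ∀ {B : Subset p} {b j} → b ∈ B → adj G b j ≡ true → j ∈ N G B
  N⁺ {B} {b} {j} b∈B bj = lookup⇒[]= j (N G B)
    (trans (lookup∘tabulate _ j) (anyFin⁺ (λ b′ → lookup B b′ ∧ adj G b′ j) Bb∧bj))
    where
    Bb∧bj : lookup B b ∧ adj G b j ≡ true
    Bb∧bj rewrite []=⇒lookup b∈B = bj

  N⁻ : ∀ {B : Subset p} {j} → j ∈ N G B → ∃ λ b → b ∈ B × adj G b j ≡ true
  N⁻ {B} {j} j∈NB with anyFin⁻ (λ b → lookup B b ∧ adj G b j)
                                (trans (sym (lookup∘tabulate _ j)) ([]=⇒lookup j∈NB))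
  ... | b , Bb∧bj with lookup B b in Bb
  ...   | true = b , lookup⇒[]= b B Bb , Bb∧bj

  surplus : Subset p → Vecℚ p
  surplus B k = 𝟙 (N G B) k - 𝟙 B k

  surplus-· : ∀ B x → surplus B · x ≡ sumOn (N G B) x - sumOn B x
  surplus-· B x = trans (·-distribʳ-sub (𝟙 (N G B)) (𝟙 B) x)
                        (sym (cong₂ _-_ (sumOn≡𝟙· (N G B) x) (sumOn≡𝟙· B x)))

  H⁻⇔0≤surplus· : ∀ B x → H⁻ G B x ⇔ 0ℚ ≤ surplus B · x
  H⁻⇔0≤surplus· B x = mk⇔
    (λ B≤NB → ≤-trans (p≤q⇒0≤q-p B≤NB) (≤-reflexive (sym (surplus-· B x))))
    (λ 0≤ψx → 0≤q-p⇒p≤q (≤-trans 0≤ψx (≤-reflexive (surplus-· B x))))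

  H⇒surplus·≡0 : ∀ B x → H G B x → surplus B · x ≡ 0ℚ
  H⇒surplus·≡0 B x B≡NB =
    trans (surplus-· B x) (trans (cong (_- sumOn B x) (sym B≡NB)) (+-inverseʳ (sumOn B x)))

  sameOnAff : ∀ {S T : Vecℚ p → Set} (a b c : Vecℚ p) →
    (∀ x → S x ⇔ 0ℚ ≤ a · x) → (∀ x → T x ⇔ 0ℚ ≤ b · x) →
    (∀ k → a k ≡ b k + c k) → (∀ {i j} → adj G i j ≡ true → c i + c j ≡ 0ℚ) →
    SameOnAff G S T
  sameOnAff a b c S⇔ T⇔ a≗b+c c⊥edges x x∈aff =
    (λ Sx → Equivalence.from (T⇔ x) (subst (0ℚ ≤_) a·x≡b·x (Equivalence.to (S⇔ x) Sx))) ,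
    (λ Tx → Equivalence.from (S⇔ x) (subst (0ℚ ≤_) (sym a·x≡b·x) (Equivalence.to (T⇔ x) Tx)))
    where
    a·x≡b·x : a · x ≡ b · x
    a·x≡b·x = begin
      a · x                      ≡⟨ Σᶠ-cong (λ k → cong (_* x k) (a≗b+c k)) ⟩
      (λ k → b k + c k) · x      ≡⟨ ·-distribʳ-+ b c x ⟩
      b · x + c · x              ≡⟨ cong (b · x +_) (·-Aff'≡0 G c c⊥edges x x∈aff) ⟩
      b · x + 0ℚ                 ≡⟨ +-identityʳ (b · x) ⟩
      b · x                      ∎
      where open ≡-Reasoning

-- Walks and components

stabilises : ∀ {n} (S : ℕ → Subset n) → (∀ k → S k ⊆ S (suc k)) → ∃ λ m → S (suc m) ⊆ S m
stabilises {n} S increasing with grows (suc n)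
  where
  grows : ∀ k → (∃ λ m → S (suc m) ⊆ S m) ⊎ k ℕ.≤ ∣ S k ∣
  grows zero = inj₂ z≤n
  grows (suc k) with grows k
  ... | inj₁ stable = inj₁ stable
  ... | inj₂ k≤∣Sk∣ with nonempty? (S (suc k) ─ S k)
  ...   | no  new≡∅       = inj₁ (k , ¬Nonempty[p─q]⇒p⊆q new≡∅)
  ...   | yes (x , x∈new) = inj₂ (ℕ.≤-<-trans k≤∣Sk∣ (p⊂q⇒∣p∣<∣q∣ Sk⊂Sk+1))
    where
    Sk⊂Sk+1 : S k ⊂ S (suc k)
    Sk⊂Sk+1 = increasing k , x , p─q⊆p _ _ x∈new , x∈p─q⇒x∉q _ _ x∈new
... | inj₁ stable  = stable
... | inj₂ n+1≤∣S∣ = contradiction (ℕ.≤-trans n+1≤∣S∣ (∣p∣≤n (S (suc n)))) ℕ.1+n≰n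

module _ {p} (G : SimpleGraph p) where

  adj-sym′ : ∀ {i j} → adj G i j ≡ true → adj G j i ≡ true
  adj-sym′ {i} {j} ij = trans (adj-sym G j i) ij

  adj⇒≢ : ∀ {i j} → adj G i j ≡ true → i ≢ j
  adj⇒≢ {i} ij refl = true≢false ij (adj-irrefl G i)

  hasNeighbour : Connected G → ∀ {i j} → i ≢ j → ∃ λ u → adj G i u ≡ true
  hasNeighbour conn {i} {j} i≢j with conn i j
  ... | here _        = contradiction refl i≢j
  ... | step _ iu _   = _ , iu

  walk-end : ∀ {allowed : Fin p → Set} {i j} → Walk G allowed i j → allowed j
  walk-end (here j-allowed) = j-allowed
  walk-end (step _ _ walk)  = walk-end walk

  walk-snoc : ∀ {allowed : Fin p → Set} {i j k} →
    Walk G allowed i j → adj G j k ≡ true → allowed k → Walk G allowed i k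
  walk-snoc (here i-allowed)        jk k-allowed = step i-allowed jk (here k-allowed)
  walk-snoc (step i-allowed iu walk) jk k-allowed = step i-allowed iu (walk-snoc walk jk k-allowed)

  exitEdge : ∀ {allowed : Fin p → Set} {i j} (S : Subset p) →
    Walk G allowed i j → i ∈ S → j ∉ S → ∃₂ λ x y → x ∈ S × y ∉ S × adj G x y ≡ true
  exitEdge S (here _)               i∈S i∉S = contradiction i∈S i∉S
  exitEdge S (step {j = u} _ iu walk) i∈S j∉S with u ∈? S
  ... | yes u∈S = exitEdge S walk u∈S j∉S
  ... | no  u∉S = _ , u , i∈S , u∉S , iu

  neighbourIn : Connected G → (S : Subset p) → ∀ {x₀ v} → x₀ ∈ S → v ∉ S →
    (∀ {x y} → x ∈ S → adj G x y ≡ true → y ≢ v → y ∈ S) →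
    ∃ λ u → u ∈ S × adj G v u ≡ true
  neighbourIn conn S {x₀} {v} x₀∈S v∉S closed with exitEdge S (conn x₀ v) x₀∈S v∉S
  ... | x , y , x∈S , y∉S , xy with y ≟ v
  ...   | yes refl = x , x∈S , adj-sym′ xy
  ...   | no  y≢v  = contradiction (closed x∈S xy y≢v) y∉S

module ComponentAvoiding {p} (G : SimpleGraph p) (v j : Fin p) where

  reachableWithin : ℕ → Subset p
  reachableWithin zero    = ⁅ j ⁆
  reachableWithin (suc k) = reachableWithin k ∪ (N G (reachableWithin k) ─ ⁅ v ⁆)

  private
    increasing : ∀ k → reachableWithin k ⊆ reachableWithin (suc k)
    increasing k = p⊆p∪q _

    stable : ∃ λ m → reachableWithin (suc m) ⊆ reachableWithin m
    stable = stabilises reachableWithin increasing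

  C : Subset p
  C = reachableWithin (proj₁ stable)

  j∈C : j ∈ C
  j∈C = j∈reachable (proj₁ stable)
    where
    j∈reachable : ∀ k → j ∈ reachableWithin k
    j∈reachable zero    = x∈⁅x⁆ j
    j∈reachable (suc k) = increasing k (j∈reachable k)

  C-closed : ∀ {x y} → x ∈ C → adj G x y ≡ true → y ≢ v → y ∈ C
  C-closed x∈C xy y≢v =
    proj₂ stable (x∈p∪q⁺ (inj₂ (x∈p∧x∉q⇒x∈p─q (N⁺ G x∈C xy) (x≢y⇒x∉⁅y⁆ y≢v))))

  C⇒walk : j ≢ v → ∀ {x} → x ∈ C → Walk G (_≢ v) j x
  C⇒walk j≢v = walk (proj₁ stable)
    where
    walk : ∀ k {x} → x ∈ reachableWithin k → Walk G (_≢ v) j x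
    walk zero x∈⁅j⁆ rewrite x∈⁅y⁆⇒x≡y j x∈⁅j⁆ = here j≢v
    walk (suc k) x∈ with x∈p∪q⁻ _ _ x∈
    ... | inj₁ x∈R = walk k x∈R
    ... | inj₂ x∈new with N⁻ G (p─q⊆p _ _ x∈new)
    ...   | b , b∈R , bx = walk-snoc G (walk k b∈R) bx (x∉⁅y⁆⇒x≢y (x∈p─q⇒x∉q _ _ x∈new))

  v∉C : j ≢ v → v ∉ C
  v∉C j≢v v∈C = walk-end G (C⇒walk j≢v v∈C) refl

  rest : Subset p
  rest = ∁ C ─ ⁅ v ⁆

  rest⁻ : ∀ {x} → x ∈ rest → x ∉ C × x ≢ v
  rest⁻ x∈rest with x∈p─q⁻ (∁ C) ⁅ v ⁆ x∈rest
  ... | x∈∁C , x∉⁅v⁆ = x∈∁p⇒x∉p x∈∁C , x∉⁅y⁆⇒x≢y x∉⁅v⁆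

  rest⁺ : ∀ {x} → x ∉ C → x ≢ v → x ∈ rest
  rest⁺ x∉C x≢v = x∈p∧x∉q⇒x∈p─q (x∉p⇒x∈∁p x∉C) (x≢y⇒x∉⁅y⁆ x≢v)

  rest-closed : ∀ {x y} → x ∈ rest → adj G x y ≡ true → y ≢ v → y ∈ rest
  rest-closed x∈rest xy y≢v with rest⁻ x∈rest
  ... | x∉C , x≢v = rest⁺ (λ y∈C → x∉C (C-closed y∈C (adj-sym′ G xy) x≢v)) y≢v

-- The bipartite case

module Bipartite {p} (G : SimpleGraph p) (V₁ V₂ : Subset p) (bip : IsBipartition G V₁ V₂)
                 (A₂ : Subset p) (A₂⊆V₂ : A₂ ⊆ V₂) where

  N₂ A₁ N₁ : Subset p
  N₂ = N G A₂
  A₁ = V₁ ─ N₂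
  N₁ = N G A₁

  ψ₂ ψ₁ σ : Vecℚ p
  ψ₂ = surplus G A₂
  ψ₁ = surplus G A₁
  σ k = 𝟙 V₁ k - 𝟙 V₂ k

  Face : Vecℚ p → Set
  Face x = H G A₂ x × EdgeCone G x

  A₁⊆V₁ : A₁ ⊆ V₁
  A₁⊆V₁ = p─q⊆p V₁ N₂

  V₁⇒∉V₂ : ∀ {k} → k ∈ V₁ → k ∉ V₂
  V₁⇒∉V₂ {k} k∈V₁ with proj₁ bip k
  ... | inj₁ (_ , k∉V₂) = k∉V₂
  ... | inj₂ (k∉V₁ , _) = contradiction k∈V₁ k∉V₁

  V₁≢V₂ : ∀ {i j} → i ∈ V₁ → j ∈ V₂ → i ≢ j
  V₁≢V₂ i∈V₁ j∈V₂ refl = V₁⇒∉V₂ i∈V₁ j∈V₂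

  adj-V₂⇒V₁ : ∀ {i j} → adj G i j ≡ true → i ∈ V₂ → j ∈ V₁
  adj-V₂⇒V₁ ij i∈V₂ with proj₂ bip _ _ ij
  ... | inj₁ (i∈V₁ , _) = contradiction i∈V₂ (V₁⇒∉V₂ i∈V₁)
  ... | inj₂ (_ , j∈V₁) = j∈V₁

  adj-V₁⇒V₂ : ∀ {i j} → adj G i j ≡ true → i ∈ V₁ → j ∈ V₂
  adj-V₁⇒V₂ ij i∈V₁ with proj₂ bip _ _ ij
  ... | inj₁ (_ , j∈V₂) = j∈V₂
  ... | inj₂ (i∈V₂ , _) = contradiction i∈V₂ (V₁⇒∉V₂ i∈V₁)

  oriented : (a : Vecℚ p) (P : ℚ → Set) →
    (∀ {i j} → i ∈ V₁ → j ∈ V₂ → adj G i j ≡ true → P (a i + a j)) →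
    ∀ {i j} → adj G i j ≡ true → P (a i + a j)
  oriented a P P-oriented {i} {j} ij with proj₂ bip i j ij
  ... | inj₁ (i∈V₁ , j∈V₂) = P-oriented i∈V₁ j∈V₂ ij
  ... | inj₂ (i∈V₂ , j∈V₁) = subst P (+-comm (a j) (a i)) (P-oriented j∈V₁ i∈V₂ (adj-sym′ G ij))

  N₂⊆V₁ : N₂ ⊆ V₁
  N₂⊆V₁ k∈N₂ with N⁻ G k∈N₂
  ... | b , b∈A₂ , bk = adj-V₂⇒V₁ bk (A₂⊆V₂ b∈A₂)

  N₁⊆V₂ : N₁ ⊆ V₂
  N₁⊆V₂ k∈N₁ with N⁻ G k∈N₁
  ... | b , b∈A₁ , bk = adj-V₁⇒V₂ bk (A₁⊆V₁ b∈A₁)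

  N₁⇒∉A₂ : ∀ {k} → k ∈ N₁ → k ∉ A₂
  N₁⇒∉A₂ k∈N₁ k∈A₂ with N⁻ G k∈N₁
  ... | b , b∈A₁ , bk = x∈p─q⇒x∉q V₁ N₂ b∈A₁ (N⁺ G k∈A₂ (adj-sym′ G bk))

  N₂⇒∉A₁ : ∀ {k} → k ∈ N₂ → k ∉ A₁
  N₂⇒∉A₁ k∈N₂ k∈A₁ = x∈p─q⇒x∉q V₁ N₂ k∈A₁ k∈N₂

  V₂⇒∉A₁ : ∀ {k} → k ∈ V₂ → k ∉ A₁
  V₂⇒∉A₁ k∈V₂ k∈A₁ = V₁⇒∉V₂ (A₁⊆V₁ k∈A₁) k∈V₂

  V₁⇒∉N₁ : ∀ {k} → k ∈ V₁ → k ∉ N₁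
  V₁⇒∉N₁ k∈V₁ = V₁⇒∉V₂ k∈V₁ ∘ N₁⊆V₂

  V₁⇒N₂⊎A₁ : ∀ {k} → k ∈ V₁ → k ∈ N₂ ⊎ k ∈ A₁
  V₁⇒N₂⊎A₁ {k} k∈V₁ with k ∈? N₂
  ... | yes k∈N₂ = inj₁ k∈N₂
  ... | no  k∉N₂ = inj₂ (x∈p∧x∉q⇒x∈p─q k∈V₁ k∉N₂)

  -- Closed rational arithmetic such as 1ℚ - 0ℚ ≡ 1ℚ holds by evaluation.
  ψ₂-N₂ : ∀ {k} → k ∈ N₂ → ψ₂ k ≡ 1ℚ
  ψ₂-N₂ k∈N₂ = cong₂ _-_ (𝟙-∈ k∈N₂) (𝟙-∉ (V₁⇒∉V₂ (N₂⊆V₁ k∈N₂) ∘ A₂⊆V₂))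

  ψ₂-A₁ : ∀ {k} → k ∈ A₁ → ψ₂ k ≡ 0ℚ
  ψ₂-A₁ k∈A₁ = cong₂ _-_ (𝟙-∉ (x∈p─q⇒x∉q V₁ N₂ k∈A₁)) (𝟙-∉ (V₁⇒∉V₂ (A₁⊆V₁ k∈A₁) ∘ A₂⊆V₂))

  ψ₂-A₂ : ∀ {k} → k ∈ A₂ → ψ₂ k ≡ - 1ℚ
  ψ₂-A₂ k∈A₂ = cong₂ _-_ (𝟙-∉ (λ k∈N₂ → V₁⇒∉V₂ (N₂⊆V₁ k∈N₂) (A₂⊆V₂ k∈A₂))) (𝟙-∈ k∈A₂)

  ψ₂-V₂─A₂ : ∀ {k} → k ∈ V₂ → k ∉ A₂ → ψ₂ k ≡ 0ℚ
  ψ₂-V₂─A₂ k∈V₂ k∉A₂ = cong₂ _-_ (𝟙-∉ (λ k∈N₂ → V₁⇒∉V₂ (N₂⊆V₁ k∈N₂) k∈V₂)) (𝟙-∉ k∉A₂)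

  σ-V₁ : ∀ {k} → k ∈ V₁ → σ k ≡ 1ℚ
  σ-V₁ k∈V₁ = cong₂ _-_ (𝟙-∈ k∈V₁) (𝟙-∉ (V₁⇒∉V₂ k∈V₁))

  σ-V₂ : ∀ {k} → k ∈ V₂ → σ k ≡ - 1ℚ
  σ-V₂ k∈V₂ = cong₂ _-_ (𝟙-∉ (λ k∈V₁ → V₁⇒∉V₂ k∈V₁ k∈V₂)) (𝟙-∈ k∈V₂)

  σ-edge : ∀ {i j} → adj G i j ≡ true → σ i + σ j ≡ 0ℚ
  σ-edge = oriented σ (_≡ 0ℚ) (λ i∈V₁ j∈V₂ _ → cong₂ _+_ (σ-V₁ i∈V₁) (σ-V₂ j∈V₂))

  ψ₂-edge : ∀ {i j} → adj G i j ≡ true → ψ₂ i + ψ₂ j ≡ 0ℚ ⊎ ψ₂ i + ψ₂ j ≡ 1ℚ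
  ψ₂-edge = oriented ψ₂ (λ s → s ≡ 0ℚ ⊎ s ≡ 1ℚ) edge
    where
    edge : ∀ {i j} → i ∈ V₁ → j ∈ V₂ → adj G i j ≡ true → ψ₂ i + ψ₂ j ≡ 0ℚ ⊎ ψ₂ i + ψ₂ j ≡ 1ℚ
    edge {i} {j} i∈V₁ j∈V₂ ij with j ∈? A₂ | V₁⇒N₂⊎A₁ i∈V₁
    ... | yes j∈A₂ | _         = inj₁ (cong₂ _+_ (ψ₂-N₂ (N⁺ G j∈A₂ (adj-sym′ G ij))) (ψ₂-A₂ j∈A₂))
    ... | no  j∉A₂ | inj₁ i∈N₂ = inj₂ (cong₂ _+_ (ψ₂-N₂ i∈N₂) (ψ₂-V₂─A₂ j∈V₂ j∉A₂))
    ... | no  j∉A₂ | inj₂ i∈A₁ = inj₁ (cong₂ _+_ (ψ₂-A₁ i∈A₁) (ψ₂-V₂─A₂ j∈V₂ j∉A₂))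

  -- The face only uses edges between A₂ and N₂ and between A₁ and V₂ ∖ A₂.
  face-⊥-avoiding : ∀ {v} → v ∈ V₂ → v ∉ A₂ → (∀ {i} → adj G i v ≡ true → i ∈ N₂) →
    (a : Vecℚ p) → (∀ {i j} → adj G i j ≡ true → i ≢ v → j ≢ v → a i + a j ≡ 0ℚ) →
    ∀ x → Face x → a · x ≡ 0ℚ
  face-⊥-avoiding {v} v∈V₂ v∉A₂ N[v]⊆N₂ a a⊥ x (Hx , x∈Q) =
    face-⊥ G ψ₂ a ψ₂-edge a⊥tight x x∈Q (H⇒surplus·≡0 G A₂ x Hx)
    where
    tight⇒≢v : ∀ {i j} → adj G i j ≡ true → ψ₂ i + ψ₂ j ≡ 0ℚ → j ≢ v
    tight⇒≢v ij tight refl =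
      1ℚ≢0ℚ (trans (sym (cong₂ _+_ (ψ₂-N₂ (N[v]⊆N₂ ij)) (ψ₂-V₂─A₂ v∈V₂ v∉A₂))) tight)

    a⊥tight : ∀ {i j} → adj G i j ≡ true → ψ₂ i + ψ₂ j ≡ 0ℚ → a i + a j ≡ 0ℚ
    a⊥tight {i} {j} ij tight =
      a⊥ ij (tight⇒≢v (adj-sym′ G ij) (trans (+-comm (ψ₂ j) (ψ₂ i)) tight)) (tight⇒≢v ij tight)

  ψ₂⊥Face : ∀ x → Face x → ψ₂ · x ≡ 0ℚ
  ψ₂⊥Face x (Hx , _) = H⇒surplus·≡0 G A₂ x Hx

  sameOnAff-A₁ : V₂ ─ A₂ ⊆ N₁ → SameOnAff G (H⁻ G A₂) (H⁻ G A₁)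
  sameOnAff-A₁ V₂─A₂⊆N₁ =
    sameOnAff G ψ₂ ψ₁ σ (H⁻⇔0≤surplus· G A₂) (H⁻⇔0≤surplus· G A₁) ψ₂≗ψ₁+σ σ-edge
    where
    ψ₂≗ψ₁+σ : ∀ k → ψ₂ k ≡ ψ₁ k + σ k
    ψ₂≗ψ₁+σ k with proj₁ bip k
    ... | inj₁ (k∈V₁ , _) with V₁⇒N₂⊎A₁ k∈V₁
    ...   | inj₁ k∈N₂ = trans (ψ₂-N₂ k∈N₂)
      (sym (cong₂ _+_ (cong₂ _-_ (𝟙-∉ (V₁⇒∉N₁ k∈V₁)) (𝟙-∉ (N₂⇒∉A₁ k∈N₂))) (σ-V₁ k∈V₁)))
    ...   | inj₂ k∈A₁ = trans (ψ₂-A₁ k∈A₁)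
      (sym (cong₂ _+_ (cong₂ _-_ (𝟙-∉ (V₁⇒∉N₁ k∈V₁)) (𝟙-∈ k∈A₁)) (σ-V₁ k∈V₁)))
    ψ₂≗ψ₁+σ k | inj₂ (_ , k∈V₂) with k ∈? A₂
    ...   | yes k∈A₂ = trans (ψ₂-A₂ k∈A₂)
      (sym (cong₂ _+_ (cong₂ _-_ (𝟙-∉ (λ k∈N₁ → N₁⇒∉A₂ k∈N₁ k∈A₂)) (𝟙-∉ (V₂⇒∉A₁ k∈V₂))) (σ-V₂ k∈V₂)))
    ...   | no  k∉A₂ = trans (ψ₂-V₂─A₂ k∈V₂ k∉A₂)
      (sym (cong₂ _+_ (cong₂ _-_ (𝟙-∈ (V₂─A₂⊆N₁ (x∈p∧x∉q⇒x∈p─q k∈V₂ k∉A₂))) (𝟙-∉ (V₂⇒∉A₁ k∈V₂)))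
                      (σ-V₂ k∈V₂)))

  sameOnAff-e : V₁ ⊆ N₂ → ∀ {i₁} → i₁ ∈ V₂ → i₁ ∉ A₂ → V₂ ─ A₂ ⊆ ⁅ i₁ ⁆ →
    SameOnAff G (H⁻ G A₂) (H⁺e i₁)
  sameOnAff-e V₁⊆N₂ {i₁} i₁∈V₂ i₁∉A₂ V₂─A₂⊆⁅i₁⁆ =
    sameOnAff G ψ₂ (e i₁) σ (H⁻⇔0≤surplus· G A₂) H⁺e⇔ ψ₂≗e+σ σ-edge
    where
    H⁺e⇔ : ∀ x → H⁺e i₁ x ⇔ 0ℚ ≤ e i₁ · x
    H⁺e⇔ x = mk⇔ (subst (0ℚ ≤_) (sym (e-· i₁ x))) (subst (0ℚ ≤_) (e-· i₁ x))

    ψ₂≗e+σ : ∀ k → ψ₂ k ≡ e i₁ k + σ k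
    ψ₂≗e+σ k with proj₁ bip k
    ... | inj₁ (k∈V₁ , _) = trans (ψ₂-N₂ (V₁⊆N₂ k∈V₁))
      (sym (cong₂ _+_ (e-offdiag (≢-sym (V₁≢V₂ k∈V₁ i₁∈V₂))) (σ-V₁ k∈V₁)))
    ... | inj₂ (_ , k∈V₂) with k ∈? A₂
    ...   | yes k∈A₂ = trans (ψ₂-A₂ k∈A₂)
      (sym (cong₂ _+_ (e-offdiag {i = i₁} {k} (λ { refl → i₁∉A₂ k∈A₂ })) (σ-V₂ k∈V₂)))
    ...   | no  k∉A₂ with x∈⁅y⁆⇒x≡y i₁ (V₂─A₂⊆⁅i₁⁆ (x∈p∧x∉q⇒x∈p─q k∈V₂ k∉A₂))
    ...     | refl = trans (ψ₂-V₂─A₂ k∈V₂ k∉A₂) (sym (cong₂ _+_ (e-diag k) (σ-V₂ k∈V₂)))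

  masked-σ-avoiding : ∀ {v} (S : Subset p) → (∀ {x y} → x ∈ S → adj G x y ≡ true → y ≢ v → y ∈ S) →
    ∀ {i j} → adj G i j ≡ true → i ≢ v → j ≢ v → 𝟙 S i * σ i + 𝟙 S j * σ j ≡ 0ℚ
  masked-σ-avoiding S closed {i} {j} ij i≢v j≢v with i ∈? S
  ... | yes i∈S = trans (cong₂ _+_ (𝟙*-∈ (σ i) i∈S) (𝟙*-∈ (σ j) (closed i∈S ij j≢v))) (σ-edge ij)
  ... | no  i∉S = cong₂ _+_ (𝟙*-∉ (σ i) i∉S) (𝟙*-∉ (σ j) (i∉S ∘ λ j∈S → closed j∈S (adj-sym′ G ij) i≢v))

  V₁⊆N₂⇒N[V₂]⊆N₂ : V₁ ⊆ N₂ → ∀ {v i} → v ∈ V₂ → adj G i v ≡ true → i ∈ N₂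
  V₁⊆N₂⇒N[V₂]⊆N₂ V₁⊆N₂ v∈V₂ iv = V₁⊆N₂ (adj-V₂⇒V₁ (adj-sym′ G iv) v∈V₂)

  e⊥Face : V₁ ⊆ N₂ → ∀ {v} → v ∈ V₂ → v ∉ A₂ → ∀ x → Face x → e v · x ≡ 0ℚ
  e⊥Face V₁⊆N₂ {v} v∈V₂ v∉A₂ =
    face-⊥-avoiding v∈V₂ v∉A₂ (V₁⊆N₂⇒N[V₂]⊆N₂ V₁⊆N₂ v∈V₂) (e v) (λ _ → e-avoiding)

  outside-N₁⇒¬Codim1 : Connected G → Nonempty A₁ → ∀ {v} → v ∈ V₂ → v ∉ A₂ → v ∉ N₁ →
    ¬ Codim1 (EdgeCone G) Face
  outside-N₁⇒¬Codim1 conn (a₁ , a₁∈A₁) {v} v∈V₂ v∉A₂ v∉N₁ =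
    contradicts (hasNeighbour G conn (V₁≢V₂ (A₁⊆V₁ a₁∈A₁) v∈V₂ ∘ sym))
                (exitEdge G (A₁ ∪ N₁) (conn a₁ v) (x∈p∪q⁺ (inj₁ a₁∈A₁)) v∉A₁∪N₁)
    where
    v∉A₁∪N₁ : v ∉ A₁ ∪ N₁
    v∉A₁∪N₁ v∈ with x∈p∪q⁻ A₁ N₁ v∈
    ... | inj₁ v∈A₁ = V₂⇒∉A₁ v∈V₂ v∈A₁
    ... | inj₂ v∈N₁ = v∉N₁ v∈N₁

    N[v]⊆N₂ : ∀ {i} → adj G i v ≡ true → i ∈ N₂
    N[v]⊆N₂ iv with V₁⇒N₂⊎A₁ (adj-V₂⇒V₁ (adj-sym′ G iv) v∈V₂)
    ... | inj₁ i∈N₂ = i∈N₂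
    ... | inj₂ i∈A₁ = contradiction (N⁺ G i∈A₁ iv) v∉N₁

    contradicts : (∃ λ u → adj G v u ≡ true) →
      (∃₂ λ x y → x ∈ A₁ ∪ N₁ × y ∉ A₁ ∪ N₁ × adj G x y ≡ true) → ¬ Codim1 (EdgeCone G) Face
    contradicts (u , vu) (x , y , x∈S , y∉S , xy) =
      two-functionals⇒¬Codim1 (e v) ψ₂ (edgePoint v u) (edgePoint x y) (λ _ → proj₂)
        (face-⊥-avoiding v∈V₂ v∉A₂ N[v]⊆N₂ (e v) (λ _ → e-avoiding)) ψ₂⊥Face
        (edgePoint∈EdgeCone G vu) (edgePoint∈EdgeCone G xy)
        (e·edgePoint-incident (adj⇒≢ G vu ∘ sym))
        (e·edgePoint-avoiding x≢v (V₁≢V₂ y∈V₁ v∈V₂))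
        (trans (·-edgePoint ψ₂ x y) (cong₂ _+_ (ψ₂-V₂─A₂ x∈V₂ (N₁⇒∉A₂ x∈N₁)) (ψ₂-N₂ y∈N₂)))
      where
      x∈N₁ : x ∈ N₁
      x∈N₁ with x∈p∪q⁻ A₁ N₁ x∈S
      ... | inj₁ x∈A₁ = contradiction (x∈p∪q⁺ (inj₂ (N⁺ G x∈A₁ xy))) y∉S
      ... | inj₂ x∈N₁ = x∈N₁

      x≢v : x ≢ v
      x≢v refl = v∉N₁ x∈N₁

      x∈V₂ : x ∈ V₂
      x∈V₂ = N₁⊆V₂ x∈N₁

      y∈V₁ : y ∈ V₁
      y∈V₁ = adj-V₂⇒V₁ xy x∈V₂

      y∈N₂ : y ∈ N₂
      y∈N₂ with V₁⇒N₂⊎A₁ y∈V₁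
      ... | inj₁ y∈N₂ = y∈N₂
      ... | inj₂ y∈A₁ = contradiction (x∈p∪q⁺ (inj₁ y∈A₁)) y∉S

  two-outside-A₂⇒¬Codim1 : Connected G → V₁ ⊆ N₂ → ∀ {v w} → v ∈ V₂ → v ∉ A₂ → w ∈ V₂ → w ∉ A₂ →
    w ≢ v → ¬ Codim1 (EdgeCone G) Face
  two-outside-A₂⇒¬Codim1 conn V₁⊆N₂ {v} {w} v∈V₂ v∉A₂ w∈V₂ w∉A₂ w≢v =
    contradicts (hasNeighbour G conn (w≢v ∘ sym)) (hasNeighbour G conn w≢v)
    where
    contradicts : (∃ λ u → adj G v u ≡ true) → (∃ λ u → adj G w u ≡ true) →
      ¬ Codim1 (EdgeCone G) Face
    contradicts (u , vu) (u′ , wu′) =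
      two-functionals⇒¬Codim1 (e v) (e w) (edgePoint v u) (edgePoint w u′) (λ _ → proj₂)
        (e⊥Face V₁⊆N₂ v∈V₂ v∉A₂) (e⊥Face V₁⊆N₂ w∈V₂ w∉A₂)
        (edgePoint∈EdgeCone G vu) (edgePoint∈EdgeCone G wu′)
        (e·edgePoint-incident (adj⇒≢ G vu ∘ sym))
        (e·edgePoint-avoiding w≢v (V₁≢V₂ (adj-V₂⇒V₁ wu′ w∈V₂) v∈V₂))
        (e·edgePoint-incident (adj⇒≢ G wu′ ∘ sym))

  codim1⇒connectedWithout : Connected G → V₁ ⊆ N₂ → ∀ {i₀} → i₀ ∈ V₂ → i₀ ∉ A₂ →
    Codim1 (EdgeCone G) Face → ConnectedWithout G i₀
  codim1⇒connectedWithout conn V₁⊆N₂ {i₀} i₀∈V₂ i₀∉A₂ codim1 j k j≢i₀ k≢i₀ = walk (k ∈? C)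
    where
    open ComponentAvoiding G i₀ j

    σC : Vecℚ p
    σC x = 𝟙 C x * σ x

    contradicts : (∃ λ u → u ∈ C × adj G i₀ u ≡ true) → (∃ λ u → u ∈ rest × adj G i₀ u ≡ true) →
      ¬ Codim1 (EdgeCone G) Face
    contradicts (u , u∈C , i₀u) (u′ , u′∈rest , i₀u′) =
      two-functionals⇒¬Codim1 σC (e i₀) (edgePoint i₀ u) (edgePoint i₀ u′) (λ _ → proj₂)
        (face-⊥-avoiding i₀∈V₂ i₀∉A₂ (V₁⊆N₂⇒N[V₂]⊆N₂ V₁⊆N₂ i₀∈V₂) σC (masked-σ-avoiding C C-closed))
        (e⊥Face V₁⊆N₂ i₀∈V₂ i₀∉A₂)
        (edgePoint∈EdgeCone G i₀u) (edgePoint∈EdgeCone G i₀u′)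
        (trans (·-edgePoint σC i₀ u)
               (cong₂ _+_ (𝟙*-∉ (σ i₀) (v∉C j≢i₀)) (trans (𝟙*-∈ (σ u) u∈C) (σ-V₁ u∈V₁))))
        (trans (·-edgePoint σC i₀ u′)
               (cong₂ _+_ (𝟙*-∉ (σ i₀) (v∉C j≢i₀)) (𝟙*-∉ (σ u′) (proj₁ (rest⁻ u′∈rest)))))
        (e·edgePoint-incident (proj₂ (rest⁻ u′∈rest)))
      where
      u∈V₁ : u ∈ V₁
      u∈V₁ = adj-V₂⇒V₁ i₀u i₀∈V₂

    walk : Dec (k ∈ C) → Walk G (_≢ i₀) j k
    walk (yes k∈C) = C⇒walk j≢i₀ k∈C
    walk (no  k∉C) = contradiction codim1 (contradicts
      (neighbourIn G conn C j∈C (v∉C j≢i₀) C-closed)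
      (neighbourIn G conn rest (rest⁺ k∉C k≢i₀) (λ i₀∈rest → proj₂ (rest⁻ i₀∈rest) refl) rest-closed))

  V₂─A₂─⁻ : ∀ {v} (B : Subset p) → v ∈ (V₂ ─ A₂) ─ B → v ∈ V₂ × v ∉ A₂ × v ∉ B
  V₂─A₂─⁻ B v∈ with x∈p─q⁻ (V₂ ─ A₂) B v∈
  ... | v∈V₂─A₂ , v∉B = proj₁ (x∈p─q⁻ V₂ A₂ v∈V₂─A₂) , proj₂ (x∈p─q⁻ V₂ A₂ v∈V₂─A₂) , v∉B

  dichotomy : Connected G → (∃ λ i₁ → i₁ ∈ V₂ × i₁ ∉ A₂) → Codim1 (EdgeCone G) Face →
    (Nonempty A₁ × SameOnAff G (H⁻ G A₂) (H⁻ G A₁))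
    ⊎ (∃ λ i → ConnectedWithout G i × SameOnAff G (H⁻ G A₂) (H⁺e i))
  dichotomy conn (i₁ , i₁∈V₂ , i₁∉A₂) codim1 with nonempty? A₁
  ... | yes A₁≢∅ with nonempty? ((V₂ ─ A₂) ─ N₁)
  ...   | no  none   = inj₁ (A₁≢∅ , sameOnAff-A₁ (¬Nonempty[p─q]⇒p⊆q none))
  ...   | yes (v , v∈) with V₂─A₂─⁻ N₁ v∈
  ...     | v∈V₂ , v∉A₂ , v∉N₁ = contradiction codim1 (outside-N₁⇒¬Codim1 conn A₁≢∅ v∈V₂ v∉A₂ v∉N₁)
  dichotomy conn (i₁ , i₁∈V₂ , i₁∉A₂) codim1 | no A₁≡∅
    with ¬Nonempty[p─q]⇒p⊆q A₁≡∅ | nonempty? ((V₂ ─ A₂) ─ ⁅ i₁ ⁆)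
  ... | V₁⊆N₂ | no  none = inj₂ (i₁ , codim1⇒connectedWithout conn V₁⊆N₂ i₁∈V₂ i₁∉A₂ codim1
                                     , sameOnAff-e V₁⊆N₂ i₁∈V₂ i₁∉A₂ (¬Nonempty[p─q]⇒p⊆q none))
  ... | V₁⊆N₂ | yes (w , w∈) with V₂─A₂─⁻ ⁅ i₁ ⁆ w∈
  ...   | w∈V₂ , w∉A₂ , w∉⁅i₁⁆ = contradiction codim1
    (two-outside-A₂⇒¬Codim1 conn V₁⊆N₂ i₁∈V₂ i₁∉A₂ w∈V₂ w∉A₂ (x∉⁅y⁆⇒x≢y w∉⁅i₁⁆))

proposition4p3 : ∀ {p : ℕ} (G : SimpleGraph p) (V₁ V₂ : Subset p) →
    Connected G → IsBipartition G V₁ V₂ →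
    (A₂ : Subset p) → A₂ ⊂ V₂ →
    IsFacet (EdgeCone G) (λ x → H G A₂ x × EdgeCone G x) →
    (Nonempty (V₁ ─ N G A₂) ×
       SameOnAff G (H⁻ G A₂) (H⁻ G (V₁ ─ N G A₂)))
    ⊎ (∃ λ (i : Fin p) → ConnectedWithout G i × SameOnAff G (H⁻ G A₂) (H⁺e i))
proposition4p3 G V₁ V₂ conn bip A₂ (A₂⊆V₂ , V₂⊄A₂) (_ , _ , _ , _ , _ , codim1) =
  Bipartite.dichotomy G V₁ V₂ bip A₂ A₂⊆V₂ conn V₂⊄A₂ codim1
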